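{- For any finite graph $G$, $\psi(M(G))=\psi(G)+1$.
   Context: The Mycielskian $M(G)$ of $G$ has vertex set $(\{0,1\}\times V(G))\cup\{z\}$ and edge set $\{\{(0,v),(i,w)\}:\{v,w\}\in E(G),\ i\in\{0,1\}\}\cup\{\{(1,v),z\}:v\in V(G)\}$. The local chromatic number is $\psi(G)=\min_c\max_{v\in V(G)}|\{c(u):u\in N(v)\}|+1$, minimum over all proper colorings $c$ of $G$, where $N(v)$ is the neighbourhood of $v$. -}

module Defs where

open import Data.Nat using (ℕ; zero; suc; _+_; _≤_; _≟_)
open import Data.Bool using (Bool; true; false; T)
open import Data.Fin using (Fin; splitAt)
import Data.Fin as Fin
open import Data.List using (List; length; filter; deduplicate; map; allFin)
open import Data.Sum using (_⊎_; inj₁; inj₂)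
open import Data.Product using (Σ; _×_; ∃)
open import Relation.Nullary using (¬_)
open import Relation.Nullary.Decidable using (T?)
open import Relation.Binary.PropositionalEquality using (_≡_)

record Graph : Set where
  constructor graph
  field
    n   : ℕ
    adj : Fin n → Fin n → Bool
open Graph public

IsSimple : Graph → Set
IsSimple G = (∀ u v → adj G u v ≡ adj G v u) × (∀ v → adj G v v ≡ false)

-- Vertices of the Mycielskian: (0,v), (1,v), z
data MV (n : ℕ) : Set where
  lo : Fin n → MV n
  hi : Fin n → MV n
  z  : MV n

madjV : (G : Graph) → MV (n G) → MV (n G) → Bool
madjV G (lo v) (lo w) = adj G v w
madjV G (lo v) (hi w) = adj G v w
madjV G (hi v) (lo w) = adj G v w
madjV G (hi v) (hi w) = false
madjV G (hi v) z      = true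
madjV G z      (hi w) = true
madjV G (lo v) z      = false
madjV G z      (lo w) = false
madjV G z      z      = false

-- Encoding of Fin (1 + (n + n)) as Mycielskian vertices: 0 ↦ z, then (0,v)'s, then (1,v)'s.
decode : (m : ℕ) → Fin (suc (m + m)) → MV m
decode m Fin.zero = z
decode m (Fin.suc i) with splitAt m i
... | inj₁ v = lo v
... | inj₂ v = hi v

Mycielskian : Graph → Graph
Mycielskian G = graph (suc (n G + n G)) (λ a b → madjV G (decode (n G) a) (decode (n G) b))

Coloring : Graph → Set
Coloring G = Fin (n G) → ℕ

IsProper : (G : Graph) → Coloring G → Set
IsProper G c = ∀ u v → T (adj G u v) → ¬ (c u ≡ c v)

nbColors : (G : Graph) → Coloring G → Fin (n G) → ℕ
nbColors G c v = length (deduplicate _≟_ (map c (filter (λ u → T? (adj G v u)) (allFin (n G)))))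

IsLocalChromaticNumber : Graph → ℕ → Set
IsLocalChromaticNumber G k =
  (Σ (Coloring G) λ c → IsProper G c × (∀ v → suc (nbColors G c v) ≤ k))
  × (∀ c → IsProper G c → ∃ λ v → k ≤ suc (nbColors G c v))

-- A proper colouring c of G extends to M(G) by giving every (1,v) one fresh colour and z
-- another; each vertex then sees at most one colour more than in G.  Conversely, from a
-- proper colouring of M(G) let a be the colour of z and colour v by the colour of (0,v),
-- or by that of (1,v) when (0,v) has colour a.  This colouring of G avoids a, and at a
-- vertex v its neighbourhood palette together with a is seen by (0,v) if some neighbour of
-- (0,v) has colour a, and by (1,v) otherwise.
module Submission where

open import Defs
open import Data.Bool using (T)
open import Data.Empty using (⊥-elim)
open import Data.Fin using (Fin; _↑ˡ_; _↑ʳ_)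
import Data.Fin as Fin
open import Data.Fin.Properties using (splitAt-↑ˡ; splitAt-↑ʳ)
open import Data.List using (List; []; _∷_; length; filter; deduplicate; map; allFin)
open import Data.List.Extrema.Nat using (max; xs≤max)
open import Data.List.Membership.Propositional using (_∈_; _∉_)
open import Data.List.Membership.Propositional.Properties
  using (∈-map⁺; ∈-map⁻; ∈-filter⁺; ∈-filter⁻; ∈-allFin; ∈-deduplicate⁺; ∈-deduplicate⁻)
open import Data.List.Properties using (length-filter; filter-all; filter-notAll)
open import Data.List.Relation.Binary.Subset.Propositional using (_⊆_)
open import Data.List.Relation.Unary.Any using (here; there)
import Data.List.Relation.Unary.Any as Any
open import Data.List.Relation.Unary.All using (All)
import Data.List.Relation.Unary.All as All
open import Data.List.Relation.Unary.AllPairs using ([]; _∷_)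
open import Data.List.Relation.Unary.Unique.Propositional using (Unique)
open import Data.List.Relation.Unary.Unique.DecPropositional.Properties using (deduplicate-!)
open import Data.Nat using (ℕ; suc; _+_; _≤_; _<_; _≟_; z≤n; s≤s)
open import Data.List.Membership.DecPropositional _≟_ using (_∈?_)
open import Data.Nat.Properties using (≤-trans; 1+n≢n; <⇒≢)
open import Data.Product using (_×_; ∃; _,_; proj₂)
open import Function using (_∘_)
open import Relation.Binary.Definitions using (DecidableEquality)
open import Relation.Binary.PropositionalEquality using (_≡_; _≢_; refl; sym; trans; cong; subst)
open import Relation.Nullary using (yes; no; ¬?)
open import Relation.Nullary.Decidable using (T?)

module Distinct {a} {A : Set a} (_≟_ : DecidableEquality A) where

  distinct : List A → ℕ
  distinct xs = length (deduplicate _≟_ xs)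

  Unique-length-mono : ∀ {xs ys : List A} → Unique xs → xs ⊆ ys → length xs ≤ length ys
  Unique-length-mono {[]} _ _ = z≤n
  Unique-length-mono {x ∷ xs} {ys} (x∉xs ∷ xs!) x∷xs⊆ys =
    ≤-trans (s≤s (Unique-length-mono xs! xs⊆ys-x))
            (filter-notAll ≢x? ys (Any.map (λ eq ne → ne eq) (x∷xs⊆ys (here refl))))
    where
    ≢x? = ¬? ∘ (x ≟_)
    xs⊆ys-x : xs ⊆ filter ≢x? ys
    xs⊆ys-x y∈xs = ∈-filter⁺ ≢x? (x∷xs⊆ys (there y∈xs)) (All.lookup x∉xs y∈xs)

  distinct-mono-⊆ : ∀ {xs ys} → xs ⊆ ys → distinct xs ≤ distinct ys
  distinct-mono-⊆ {xs} xs⊆ys = Unique-length-mono (deduplicate-! _≟_ xs)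
    (∈-deduplicate⁺ _≟_ ∘ xs⊆ys ∘ ∈-deduplicate⁻ _≟_ xs)

  distinct-∷ : ∀ x xs → distinct (x ∷ xs) ≤ suc (distinct xs)
  distinct-∷ x xs = s≤s (length-filter (¬? ∘ (x ≟_)) (deduplicate _≟_ xs))

  distinct-∷-∉ : ∀ {x xs} → x ∉ xs → distinct (x ∷ xs) ≡ suc (distinct xs)
  distinct-∷-∉ {x} {xs} x∉xs = cong (suc ∘ length) (filter-all (¬? ∘ (x ≟_)) x∉dedup)
    where
    x∉dedup : All (x ≢_) (deduplicate _≟_ xs)
    x∉dedup = All.tabulate λ y∈ x≡y → x∉xs (subst (_∈ xs) (sym x≡y) (∈-deduplicate⁻ _≟_ xs y∈))

  distinct-<-⊆ : ∀ {x xs ys} → xs ⊆ ys → x ∈ ys → x ∉ xs → distinct xs < distinct ys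
  distinct-<-⊆ {x} {xs} {ys} xs⊆ys x∈ys x∉xs = subst (_≤ distinct ys) (distinct-∷-∉ x∉xs)
    (distinct-mono-⊆ {x ∷ xs} λ { (here refl) → x∈ys ; (there y∈xs) → xs⊆ys y∈xs })

open Distinct _≟_

neighbourColours : (H : Graph) → Coloring H → Fin (n H) → List ℕ
neighbourColours H c v = map c (filter (λ u → T? (adj H v u)) (allFin (n H)))

∈-neighbourColours⁺ : ∀ H c {v u} → T (adj H v u) → c u ∈ neighbourColours H c v
∈-neighbourColours⁺ H c {v} {u} vu = ∈-map⁺ c (∈-filter⁺ (λ u → T? (adj H v u)) (∈-allFin u) vu)

∈-neighbourColours⁻ : ∀ H c {v col} → col ∈ neighbourColours H c v →
                      ∃ λ u → T (adj H v u) × c u ≡ col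
∈-neighbourColours⁻ H c {v} col∈ with ∈-map⁻ c col∈
... | u , u∈ , col≡cu =
  u , proj₂ (∈-filter⁻ (λ u → T? (adj H v u)) {xs = allFin (n H)} u∈) , sym col≡cu

nbColors-≤ : ∀ H c v {cols} → (∀ u → T (adj H v u) → c u ∈ cols) → nbColors H c v ≤ distinct cols
nbColors-≤ H c v cols∋ = distinct-mono-⊆ λ col∈ →
  let u , vu , cu≡col = ∈-neighbourColours⁻ H c col∈ in subst (_∈ _) cu≡col (cols∋ u vu)

encode : ∀ {m} → MV m → Fin (suc (m + m))
encode {m} (lo v) = Fin.suc (v ↑ˡ m)
encode {m} (hi v) = Fin.suc (m ↑ʳ v)
encode z = Fin.zero

decode-encode : ∀ m (x : MV m) → decode m (encode x) ≡ x
decode-encode m (lo v) rewrite splitAt-↑ˡ m v m = refl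
decode-encode m (hi v) rewrite splitAt-↑ʳ m m v = refl
decode-encode m z = refl

Mycielskian-adj-encode : ∀ G {x y} → T (madjV G x y) →
                         T (adj (Mycielskian G) (encode x) (encode y))
Mycielskian-adj-encode G {x} {y} xy rewrite decode-encode (n G) x | decode-encode (n G) y = xy

∈-Mycielskian-neighbourColours⁺ : ∀ G c {x y} → T (madjV G x y) →
  c (encode y) ∈ neighbourColours (Mycielskian G) c (encode x)
∈-Mycielskian-neighbourColours⁺ G c {x} {y} xy =
  ∈-neighbourColours⁺ (Mycielskian G) c {encode x} {encode y} (Mycielskian-adj-encode G {x} {y} xy)

Mycielskian-nbColors-≤ : ∀ G (f : MV (n G) → ℕ) a {cols} →
  (∀ y → T (madjV G (decode (n G) a) y) → f y ∈ cols) →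
  nbColors (Mycielskian G) (f ∘ decode (n G)) a ≤ distinct cols
Mycielskian-nbColors-≤ G f a cols∋ =
  nbColors-≤ (Mycielskian G) (f ∘ decode (n G)) a (cols∋ ∘ decode (n G))

module Extension (G : Graph) (c : Coloring G) where

  fresh : ℕ
  fresh = suc (max 0 (map c (allFin (n G))))

  c≢fresh : ∀ v → c v ≢ fresh
  c≢fresh v =
    <⇒≢ (s≤s (All.lookup (xs≤max 0 (map c (allFin (n G)))) (∈-map⁺ c (∈-allFin v))))

  extendMV : MV (n G) → ℕ
  extendMV (lo v) = c v
  extendMV (hi v) = fresh
  extendMV z      = suc fresh

  extend : Coloring (Mycielskian G)
  extend = extendMV ∘ decode (n G)

  extendMV-proper : IsProper G c → ∀ x y → T (madjV G x y) → extendMV x ≢ extendMV y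
  extendMV-proper c-proper (lo v) (lo w) vw = c-proper v w vw
  extendMV-proper c-proper (lo v) (hi w) vw = c≢fresh v
  extendMV-proper c-proper (hi v) (lo w) vw = c≢fresh w ∘ sym
  extendMV-proper c-proper (hi v) z      _  = 1+n≢n ∘ sym
  extendMV-proper c-proper z      (hi w) _  = 1+n≢n

  extend-proper : IsProper G c → IsProper (Mycielskian G) extend
  extend-proper c-proper a b = extendMV-proper c-proper (decode (n G) a) (decode (n G) b)

  palette : MV (n G) → List ℕ
  palette (lo v) = fresh ∷ neighbourColours G c v
  palette (hi v) = suc fresh ∷ neighbourColours G c v
  palette z      = fresh ∷ []

  palette-complete : ∀ x y → T (madjV G x y) → extendMV y ∈ palette x
  palette-complete (lo v) (lo w) vw = there (∈-neighbourColours⁺ G c vw)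
  palette-complete (lo v) (hi w) _  = here refl
  palette-complete (hi v) (lo w) vw = there (∈-neighbourColours⁺ G c vw)
  palette-complete (hi v) z      _  = here refl
  palette-complete z      (hi w) _  = here refl

  distinct-palette-≤ : ∀ {k} → (∀ v → suc (nbColors G c v) ≤ k) → 1 ≤ k →
                       ∀ x → distinct (palette x) ≤ k
  distinct-palette-≤ c-bound 1≤k (lo v) =
    ≤-trans (distinct-∷ fresh (neighbourColours G c v)) (c-bound v)
  distinct-palette-≤ c-bound 1≤k (hi v) =
    ≤-trans (distinct-∷ (suc fresh) (neighbourColours G c v)) (c-bound v)
  distinct-palette-≤ c-bound 1≤k z      = 1≤k

  extend-nbColors-≤ : ∀ {k} → (∀ v → suc (nbColors G c v) ≤ k) → 1 ≤ k →
                      ∀ a → nbColors (Mycielskian G) extend a ≤ k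
  extend-nbColors-≤ c-bound 1≤k a =
    ≤-trans (Mycielskian-nbColors-≤ G extendMV a (palette-complete (decode (n G) a)))
            (distinct-palette-≤ c-bound 1≤k (decode (n G) a))

module Recolouring (G : Graph) (cM : Coloring (Mycielskian G))
                   (cM-proper : IsProper (Mycielskian G) cM) where

  M : Graph
  M = Mycielskian G

  colourOf : MV (n G) → ℕ
  colourOf = cM ∘ encode

  colourOf-proper : ∀ {x y} → T (madjV G x y) → colourOf x ≢ colourOf y
  colourOf-proper {x} {y} xy =
    cM-proper (encode x) (encode y) (Mycielskian-adj-encode G {x} {y} xy)

  zColour : ℕ
  zColour = colourOf z

  recolour : Coloring G
  recolour v with colourOf (lo v) ≟ zColour
  ... | yes _ = colourOf (hi v)
  ... | no  _ = colourOf (lo v)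

  recolour≢zColour : ∀ v → recolour v ≢ zColour
  recolour≢zColour v with colourOf (lo v) ≟ zColour
  ... | yes _     = colourOf-proper {hi v} {z} _
  ... | no  lo≢zc = lo≢zc

  recolour-lo : ∀ {v} → colourOf (lo v) ≢ zColour → recolour v ≡ colourOf (lo v)
  recolour-lo {v} lo≢zc with colourOf (lo v) ≟ zColour
  ... | yes lo≡zc = ⊥-elim (lo≢zc lo≡zc)
  ... | no  _     = refl

  recolour-proper : IsProper G recolour
  recolour-proper v w vw with colourOf (lo v) ≟ zColour | colourOf (lo w) ≟ zColour
  ... | yes v≡zc | yes w≡zc = λ _ → colourOf-proper {lo v} {lo w} vw (trans v≡zc (sym w≡zc))
  ... | yes _    | no  _    = colourOf-proper {hi v} {lo w} vw
  ... | no  _    | yes _    = colourOf-proper {lo v} {hi w} vw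
  ... | no  _    | no  _    = colourOf-proper {lo v} {lo w} vw

  recolour∈neighbourColours-lo : ∀ {v w} → T (adj G v w) →
                                 recolour w ∈ neighbourColours M cM (encode (lo v))
  recolour∈neighbourColours-lo {v} {w} vw with colourOf (lo w) ≟ zColour
  ... | yes _ = ∈-Mycielskian-neighbourColours⁺ G cM {lo v} {hi w} vw
  ... | no  _ = ∈-Mycielskian-neighbourColours⁺ G cM {lo v} {lo w} vw

  zColour∉lo⇒recolour≡lo : ∀ {v w} → zColour ∉ neighbourColours M cM (encode (lo v)) →
                           T (adj G v w) → recolour w ≡ colourOf (lo w)
  zColour∉lo⇒recolour≡lo {v} {w} zc∉lo vw = recolour-lo λ lo-w≡zc →
    zc∉lo (subst (_∈ neighbourColours M cM (encode (lo v))) lo-w≡zc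
                 (∈-Mycielskian-neighbourColours⁺ G cM {lo v} {lo w} vw))

  zColour∉neighbourColours : ∀ v → zColour ∉ neighbourColours G recolour v
  zColour∉neighbourColours v zc∈ =
    let w , _ , rw≡zc = ∈-neighbourColours⁻ G recolour zc∈ in recolour≢zColour w rw≡zc

  recolour-nbColors-< : ∀ v → ∃ λ a → nbColors G recolour v < nbColors M cM a
  recolour-nbColors-< v with zColour ∈? neighbourColours M cM (encode (lo v))
  ... | yes zc∈lo = encode (lo v) , distinct-<-⊆ ⊆lo zc∈lo (zColour∉neighbourColours v)
    where
    ⊆lo : neighbourColours G recolour v ⊆ neighbourColours M cM (encode (lo v))
    ⊆lo col∈ = let w , vw , rw≡col = ∈-neighbourColours⁻ G recolour col∈
               in subst (_∈ _) rw≡col (recolour∈neighbourColours-lo vw)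
  ... | no zc∉lo = encode (hi v) , distinct-<-⊆ ⊆hi zc∈hi (zColour∉neighbourColours v)
    where
    zc∈hi : zColour ∈ neighbourColours M cM (encode (hi v))
    zc∈hi = ∈-Mycielskian-neighbourColours⁺ G cM {hi v} {z} _
    ⊆hi : neighbourColours G recolour v ⊆ neighbourColours M cM (encode (hi v))
    ⊆hi col∈ with ∈-neighbourColours⁻ G recolour col∈
    ... | w , vw , refl = subst (_∈ _) (sym (zColour∉lo⇒recolour≡lo zc∉lo vw))
                                (∈-Mycielskian-neighbourColours⁺ G cM {hi v} {lo w} vw)

proposition4p5 : (G : Graph) → IsSimple G → (k : ℕ) →
    IsLocalChromaticNumber G k → IsLocalChromaticNumber (Mycielskian G) (suc k)
proposition4p5 G _ k ((c , c-proper , c-bound) , c-sharp) = upper , lower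
  where
  open Extension G c

  1≤k : 1 ≤ k
  1≤k = let v , _ = c-sharp c c-proper in ≤-trans (s≤s z≤n) (c-bound v)

  upper : ∃ λ cM → IsProper (Mycielskian G) cM × (∀ a → suc (nbColors (Mycielskian G) cM a) ≤ suc k)
  upper = extend , extend-proper c-proper , s≤s ∘ extend-nbColors-≤ c-bound 1≤k

  lower : ∀ cM → IsProper (Mycielskian G) cM → ∃ λ a → suc k ≤ suc (nbColors (Mycielskian G) cM a)
  lower cM cM-proper =
    let open Recolouring G cM cM-proper
        v , k≤               = c-sharp recolour recolour-proper
        a , recolour-v<cM-a = recolour-nbColors-< v
    in a , s≤s (≤-trans k≤ recolour-v<cM-a)
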